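{- If a $q$-matroid $\mathcal M$ is $\mathbb F_{q^m}$-representable, then its projectivization matroid $P(\mathcal M)$ is $\mathbb F_{q^m}$-representable.
   Context: A $q$-matroid is a pair $(E,\rho)$ where $E$ is a finite-dimensional vector space over the finite field $\mathbb F_q$ and $\rho$ assigns to each subspace a nonnegative integer with $0\le\rho(U)\le\dim U$, monotonicity and submodularity. Its projectivization matroid is $P(\mathcal M)=(\mathbb PE,r)$ with $\mathbb PE$ the set of lines of $E$ and $r(S)=\rho(\langle S\rangle)$, $\langle S\rangle$ the span of the union of lines in $S$. For a matrix $G\in\mathbb F_{q^m}^{k\times n}$ (with $\mathbb F_{q^m}$ the degree-$m$ extension of $\mathbb F_q$), the induced $q$-matroid is $(\mathbb F_q^n,\rho)$ with $\rho(V)=\mathrm{rk}_{\mathbb F_{q^m}}(G\,Y_V)$ for any $\mathbb F_q$-matrix $Y_V$ with column space $V$, and the induced matroid is $([n],r)$ with $r(A)$ the $\mathbb F_{q^m}$-rank of the columns of $G$ indexed by $A$. A $q$-matroid (resp. matroid) is $\mathbb F_{q^m}$-representable if it is (up to equivalence) the $q$-matroid (resp. matroid) induced by some such matrix, i.e. by some code $\mathcal C\le\mathbb F_{q^m}^n$. -}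

module Defs where

open import Level using (0ℓ)
open import Data.Nat using (ℕ; zero; suc; _+_; _≤_)
open import Data.Fin using (Fin)
open import Data.Fin.Subset using (Subset; _∈_)
open import Data.Vec using (Vec; []; _∷_; replicate; zipWith; map)
open import Data.Product using (Σ; _×_; _,_; proj₁; proj₂; ∃)
open import Data.Unit using (⊤)
open import Function using (_∘_)
open import Function.Bundles using (_↔_)
open import Relation.Nullary using (¬_)
open import Relation.Binary.PropositionalEquality
import Data.Vec
import Data.Fin
import Algebra.Structures as AS

record Field : Set₁ where
  infixl 6 _+ᶠ_
  infixl 7 _*ᶠ_
  field
    Carrier : Set
    _+ᶠ_ _*ᶠ_ : Carrier → Carrier → Carrier
    -ᶠ_ : Carrier → Carrier
    0ᶠ 1ᶠ : Carrier
    isCommutativeRing : AS.IsCommutativeRing {A = Carrier} _≡_ _+ᶠ_ _*ᶠ_ -ᶠ_ 0ᶠ 1ᶠ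
    0≢1 : ¬ (0ᶠ ≡ 1ᶠ)
    inverse : ∀ x → ¬ (x ≡ 0ᶠ) → Σ Carrier λ y → x *ᶠ y ≡ 1ᶠ
  open AS.IsCommutativeRing isCommutativeRing public

open Field using (Carrier; _+ᶠ_; _*ᶠ_; -ᶠ_; 0ᶠ; 1ᶠ)

FieldOfOrder : ℕ → Field → Set
FieldOfOrder q F = Carrier F ↔ Fin q

module _ (F : Field) where
  private
    A = Carrier F

  zeros : ∀ {k} → Vec A k
  zeros = replicate _ (0ᶠ F)

  _⊕_ : ∀ {k} → Vec A k → Vec A k → Vec A k
  _⊕_ = zipWith (_+ᶠ_ F)

  _⊙_ : ∀ {k} → A → Vec A k → Vec A k
  c ⊙ v = map (_*ᶠ_ F c) v

  sumV : ∀ {k j} → (Fin j → Vec A k) → Vec A k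
  sumV {j = zero}  v = zeros
  sumV {j = suc j} v = v Fin.zero ⊕ sumV (v ∘ Fin.suc)
    where import Data.Fin as Fin

  lincomb : ∀ {k j} → (Fin j → A) → (Fin j → Vec A k) → Vec A k
  lincomb c v = sumV (λ i → c i ⊙ v i)

  InSpan : ∀ {k j} → (Fin j → Vec A k) → Vec A k → Set
  InSpan {j = j} v x = Σ (Fin j → A) λ c → lincomb c v ≡ x

  LinIndep : ∀ {k j} → (Fin j → Vec A k) → Set
  LinIndep {j = j} v = (c : Fin j → A) → lincomb c v ≡ zeros → ∀ i → c i ≡ 0ᶠ F

  -- The rank (dimension of the F-span) of the sub-family {v i | P i} is r:
  -- there is a basis of that span of size r chosen among those vectors.
  IsRankOf : ∀ {k N} → (Fin N → Set) → (Fin N → Vec A k) → ℕ → Set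
  IsRankOf {N = N} P v r =
    Σ (Fin r → Fin N) λ sel →
      (∀ i → P (sel i)) × LinIndep (v ∘ sel) × (∀ j → P j → InSpan (v ∘ sel) (v j))

module VecLemmas (F : Field) where
  open Field F using (+-identityˡ; zeroʳ; zeroˡ; distribˡ; *-assoc; +-assoc; +-comm) renaming (_+ᶠ_ to _⊞_; _*ᶠ_ to _⊠_; 0ᶠ to 0#)
  open ≡-Reasoning

  ⊕-zeros : ∀ {k} (v : Vec (Carrier F) k) → _⊕_ F (zeros F) v ≡ v
  ⊕-zeros [] = refl
  ⊕-zeros (x ∷ v) = cong₂ _∷_ (+-identityˡ x) (⊕-zeros v)

  zeros⊕zeros : ∀ {k} → _⊕_ F (zeros F) (zeros F) ≡ zeros F {k}
  zeros⊕zeros = ⊕-zeros (zeros F)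

  ⊙-zeros : ∀ {k} (c : Carrier F) → _⊙_ F c (zeros F) ≡ zeros F {k}
  ⊙-zeros {zero} c = refl
  ⊙-zeros {suc k} c = cong₂ _∷_ (zeroʳ c) (⊙-zeros c)

  0⊙ : ∀ {k} (v : Vec (Carrier F) k) → _⊙_ F 0# v ≡ zeros F
  0⊙ [] = refl
  0⊙ (x ∷ v) = cong₂ _∷_ (zeroˡ x) (0⊙ v)

  ⊙-distrib : ∀ {k} c (u v : Vec (Carrier F) k) → _⊙_ F c (_⊕_ F u v) ≡ _⊕_ F (_⊙_ F c u) (_⊙_ F c v)
  ⊙-distrib c [] [] = refl
  ⊙-distrib c (x ∷ u) (y ∷ v) = cong₂ _∷_ (distribˡ c x y) (⊙-distrib c u v)

  ⊙-assoc : ∀ {k} c d (v : Vec (Carrier F) k) → _⊙_ F c (_⊙_ F d v) ≡ _⊙_ F (c ⊠ d) v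
  ⊙-assoc c d [] = refl
  ⊙-assoc c d (x ∷ v) = cong₂ _∷_ (sym (*-assoc c d x)) (⊙-assoc c d v)

  ⊕-interchange : ∀ {k} (a b c d : Vec (Carrier F) k) →
    _⊕_ F (_⊕_ F a b) (_⊕_ F c d) ≡ _⊕_ F (_⊕_ F a c) (_⊕_ F b d)
  ⊕-interchange [] [] [] [] = refl
  ⊕-interchange (a ∷ as) (b ∷ bs) (c ∷ cs) (d ∷ ds) =
    cong₂ _∷_ eq (⊕-interchange as bs cs ds)
    where
    eq : (a ⊞ b) ⊞ (c ⊞ d) ≡ (a ⊞ c) ⊞ (b ⊞ d)
    eq = begin
      (a ⊞ b) ⊞ (c ⊞ d) ≡⟨ +-assoc a b (c ⊞ d) ⟩
      a ⊞ (b ⊞ (c ⊞ d)) ≡⟨ cong (a ⊞_) (sym (+-assoc b c d)) ⟩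
      a ⊞ ((b ⊞ c) ⊞ d) ≡⟨ cong (λ z → a ⊞ (z ⊞ d)) (+-comm b c) ⟩
      a ⊞ ((c ⊞ b) ⊞ d) ≡⟨ cong (a ⊞_) (+-assoc c b d) ⟩
      a ⊞ (c ⊞ (b ⊞ d)) ≡⟨ sym (+-assoc a c (b ⊞ d)) ⟩
      (a ⊞ c) ⊞ (b ⊞ d) ∎

module _ (K : Field) (n : ℕ) where
  private
    V = Vec (Carrier K) n

  record Subspace : Set₁ where
    field
      mem : V → Set
      mem-zero : mem (zeros K)
      mem-add : ∀ {x y} → mem x → mem y → mem (_⊕_ K x y)
      mem-scale : ∀ c {x} → mem x → mem (_⊙_ K c x)
  open Subspace public

  _⊆ₛ_ : Subspace → Subspace → Set
  U ⊆ₛ W = ∀ x → mem U x → mem W x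

  _≐_ : Subspace → Subspace → Set
  U ≐ W = (U ⊆ₛ W) × (W ⊆ₛ U)

  HasDim : Subspace → ℕ → Set
  HasDim U d = Σ (Fin d → V) λ b →
    (∀ i → mem U (b i)) × LinIndep K b × (∀ x → mem U x → InSpan K b x)

  ColSpace : ∀ {j} → (Fin j → V) → Subspace → Set
  ColSpace Y U = (∀ c → mem U (Y c)) × (∀ x → mem U x → InSpan K Y x)

  private module L = VecLemmas K

  _∩ₛ_ : Subspace → Subspace → Subspace
  U ∩ₛ W = record
    { mem = λ x → mem U x × mem W x
    ; mem-zero = mem-zero U , mem-zero W
    ; mem-add = λ p q → mem-add U (proj₁ p) (proj₁ q) , mem-add W (proj₂ p) (proj₂ q)
    ; mem-scale = λ c p → mem-scale U c (proj₁ p) , mem-scale W c (proj₂ p)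
    }

  _+ₛ_ : Subspace → Subspace → Subspace
  U +ₛ W = record
    { mem = λ x → Σ V λ u → Σ V λ w → mem U u × mem W w × (_⊕_ K u w ≡ x)
    ; mem-zero = zeros K , zeros K , mem-zero U , mem-zero W , L.zeros⊕zeros
    ; mem-add = λ { (u , w , pu , pw , refl) (u' , w' , pu' , pw' , refl) →
        _⊕_ K u u' , _⊕_ K w w' , mem-add U pu pu' , mem-add W pw pw' ,
        sym (L.⊕-interchange u w u' w') }
    ; mem-scale = λ { c (u , w , pu , pw , refl) →
        _⊙_ K c u , _⊙_ K c w , mem-scale U c pu , mem-scale W c pw ,
        sym (L.⊙-distrib c u w) }
    }

  record QMatroid : Set₁ where
    field
      ρ : Subspace → ℕ
      ρ-welldef : ∀ {U W} → U ≐ W → ρ U ≡ ρ W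
      ρ-dim : ∀ U d → HasDim U d → ρ U ≤ d
      ρ-mono : ∀ U W → U ⊆ₛ W → ρ U ≤ ρ W
      ρ-submod : ∀ U W → ρ (U +ₛ W) + ρ (U ∩ₛ W) ≤ ρ U + ρ W
  open QMatroid public

  record LinAut : Set where
    field
      fun inv : V → V
      inv-fun : ∀ x → inv (fun x) ≡ x
      fun-inv : ∀ y → fun (inv y) ≡ y
      fun-add : ∀ x y → fun (_⊕_ K x y) ≡ _⊕_ K (fun x) (fun y)
      fun-scale : ∀ c x → fun (_⊙_ K c x) ≡ _⊙_ K c (fun x)
  open LinAut public

  fun-zero : (φ : LinAut) → fun φ (zeros K) ≡ zeros K
  fun-zero φ = begin
    fun φ (zeros K)                ≡⟨ cong (fun φ) (sym (L.⊙-zeros (0ᶠ K))) ⟩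
    fun φ (_⊙_ K (0ᶠ K) (zeros K)) ≡⟨ fun-scale φ (0ᶠ K) (zeros K) ⟩
    _⊙_ K (0ᶠ K) (fun φ (zeros K)) ≡⟨ L.0⊙ _ ⟩
    zeros K ∎
    where open ≡-Reasoning

  image : LinAut → Subspace → Subspace
  image φ U = record
    { mem = λ y → Σ V λ x → mem U x × (fun φ x ≡ y)
    ; mem-zero = zeros K , mem-zero U , fun-zero φ
    ; mem-add = λ { (x , px , refl) (x' , px' , refl) →
        _⊕_ K x x' , mem-add U px px' , fun-add φ x x' }
    ; mem-scale = λ { c (x , px , refl) → _⊙_ K c x , mem-scale U c px , fun-scale φ c x }
    }

  lineSub : V → Subspace
  lineSub v = record
    { mem = λ x → Σ (Carrier K) λ c → _⊙_ K c v ≡ x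
    ; mem-zero = 0ᶠ K , L.0⊙ v
    ; mem-add = λ { (c , refl) (d , refl) → (_+ᶠ_ K c d) , sym (distribV c d v) }
    ; mem-scale = λ { c (d , refl) → _*ᶠ_ K c d , sym (L.⊙-assoc c d v) }
    }
    where
    distribV : ∀ {k} c d (w : Vec (Carrier K) k) →
      _⊕_ K (_⊙_ K c w) (_⊙_ K d w) ≡ _⊙_ K (_+ᶠ_ K c d) w
    distribV c d [] = refl
    distribV c d (x ∷ w) = cong₂ _∷_ (sym (Field.distribʳ K x c d)) (distribV c d w)

  -- PE : the lines of E.  A line is presented by a nonzero vector spanning it;
  -- two presentations denote the same line iff they span the same subspace.
  Line : Set
  Line = Σ V λ v → ¬ (v ≡ zeros K)

  lineOf : Line → Subspace
  lineOf ℓ = lineSub (proj₁ ℓ)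

  SameLine : Line → Line → Set
  SameLine ℓ ℓ' = lineOf ℓ ≐ lineOf ℓ'

  data InSpanUnion (S : Line → Set) : V → Set where
    su-zero : InSpanUnion S (zeros K)
    su-elem : ∀ ℓ x → S ℓ → mem (lineOf ℓ) x → InSpanUnion S x
    su-add  : ∀ {x y} → InSpanUnion S x → InSpanUnion S y → InSpanUnion S (_⊕_ K x y)

  su-scale : ∀ {S} c {x} → InSpanUnion S x → InSpanUnion S (_⊙_ K c x)
  su-scale {S} c su-zero = subst (InSpanUnion S) (sym (L.⊙-zeros c)) su-zero
  su-scale c (su-elem ℓ x s p) = su-elem ℓ _ s (mem-scale (lineOf ℓ) c p)
  su-scale {S} c (su-add {x} {y} p q) =
    subst (InSpanUnion S) (sym (L.⊙-distrib c x y)) (su-add (su-scale c p) (su-scale c q))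

  spanUnion : (Line → Set) → Subspace
  spanUnion S = record
    { mem = InSpanUnion S
    ; mem-zero = su-zero
    ; mem-add = su-add
    ; mem-scale = su-scale
    }

  projRank : QMatroid → (Line → Set) → ℕ
  projRank M S = ρ M (spanUnion S)

sumF : (F : Field) → ∀ {j} → (Fin j → Carrier F) → Carrier F
sumF F {zero} f = 0ᶠ F
sumF F {suc j} f = _+ᶠ_ F (f Data.Fin.zero) (sumF F (f ∘ Data.Fin.suc))

record Extension (K L : Field) (m : ℕ) : Set where
  field
    ι : Carrier K → Carrier L
    ι-+ : ∀ x y → ι (_+ᶠ_ K x y) ≡ _+ᶠ_ L (ι x) (ι y)
    ι-* : ∀ x y → ι (_*ᶠ_ K x y) ≡ _*ᶠ_ L (ι x) (ι y)
    ι-1 : ι (1ᶠ K) ≡ 1ᶠ L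
    basis : Fin m → Carrier L
    basis-span : ∀ x → Σ (Fin m → Carrier K) λ c → sumF L (λ i → _*ᶠ_ L (ι (c i)) (basis i)) ≡ x
    basis-unique : ∀ (c d : Fin m → Carrier K) →
      sumF L (λ i → _*ᶠ_ L (ι (c i)) (basis i)) ≡ sumF L (λ i → _*ᶠ_ L (ι (d i)) (basis i)) →
      ∀ i → c i ≡ d i
open Extension public

module _ {K L : Field} {m : ℕ} (ext : Extension K L m) where

  -- columns of G Y, for G ∈ L^{k×n} (given by its n columns) and Y ∈ K^{n×j}
  GY : ∀ {k n j} → (Fin n → Vec (Carrier L) k) → (Fin j → Vec (Carrier K) n) → Fin j → Vec (Carrier L) k
  GY G Y c = lincomb L (λ i → ι ext (Data.Vec.lookup (Y c) i)) G

  -- M is F_{q^m}-representable: M is equivalent (via a K-linear automorphism φ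
  -- of E = K^n) to the q-matroid induced by some G ∈ L^{k×n}, i.e.
  -- ρ(V) = rk_L(G Y) for every Y whose column space is φ(V).
  QRepresentable : ∀ {n} → QMatroid K n → Set₁
  QRepresentable {n} M =
    Σ ℕ λ k → Σ (Fin n → Vec (Carrier L) k) λ G → Σ (LinAut K n) λ φ →
      ∀ (U : Subspace K n) j (Y : Fin j → Vec (Carrier K) n) →
        ColSpace K n Y (image K n φ U) → IsRankOf L (λ _ → ⊤) (GY G Y) (ρ M U)

-- A matroid (X, r) (ground set X with equality _~_, rank function r on subsets
-- of X) is L-representable: it is equivalent, via a bijection ψ : X → [N], to the
-- matroid induced by some G ∈ L^{k×N}, i.e. r(ψ⁻¹ T) = rk_L(columns of G in T).
MatRepresentable : (L : Field) (X : Set) (_~_ : X → X → Set) → ((X → Set) → ℕ) → Set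
MatRepresentable L X _~_ r =
  Σ ℕ λ k → Σ ℕ λ N → Σ (Fin N → Vec (Carrier L) k) λ G → Σ (X → Fin N) λ ψ →
    (∀ x y → x ~ y → ψ x ≡ ψ y) ×
    (∀ x y → ψ x ≡ ψ y → x ~ y) ×
    (∀ i → Σ X λ x → ψ x ≡ i) ×
    (∀ (T : Subset N) → IsRankOf L (λ i → i ∈ T) G (r (λ x → ψ x ∈ T)))

module Submission where

-- Let G and φ represent M.  Over a finite field there are finitely many lines and
-- equality of lines is decidable, so we may fix one spanning vector v_ℓ per line and
-- give the line ℓ the column G φ(v_ℓ).  For a set T of lines the vectors φ(v_ℓ),
-- ℓ ∈ T, span φ⟨T⟩, hence these columns have rank ρ⟨T⟩ = r(T).

open import Defs
open import Level using (0ℓ)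
open import Algebra.Bundles using (Group)
import Algebra.Properties.Group as GroupProperties
open import Data.Nat using (ℕ; zero; suc)
open import Data.Fin using (Fin; zero; suc)
import Data.Fin.Properties as Fin
open import Data.Fin.Subset using (Subset; _∈_; _∉_)
open import Data.Fin.Subset.Properties using (_∈?_)
open import Data.Vec using (Vec; []; _∷_; lookup)
open import Data.Vec.Properties using (map-cong; map-id; zipWith-identityʳ; lookup-replicate; ≡-dec)
open import Data.List using (List; []; _∷_; length; deduplicate; cartesianProductWith; allFin)
import Data.List as List
open import Data.List.Relation.Unary.Any using (Any; here; there; index)
open import Data.List.Relation.Unary.Any.Properties using (lookup-index)
import Data.List.Relation.Unary.All as All
open import Data.List.Relation.Unary.AllPairs using (_∷_)
open import Data.List.Membership.Propositional using () renaming (_∈_ to _∈ₗ_)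
open import Data.List.Membership.Propositional.Properties
  using (∈-lookup; ∈-map⁺; ∈-allFin; ∈-cartesianProductWith⁺)
import Data.List.Relation.Unary.Unique.Setoid as UniqueSetoid
open import Data.List.Relation.Unary.Unique.DecSetoid.Properties using (deduplicate-!)
open import Data.List.Relation.Unary.Enumerates.Setoid using (IsEnumeration)
open import Data.List.Relation.Unary.Enumerates.Setoid.Properties using (deduplicate⁺)
open import Data.Product using (Σ; ∃; _,_; proj₁; proj₂)
open import Data.Unit using (⊤; tt)
open import Data.Empty using (⊥-elim)
open import Function using (_∘_)
open import Function.Bundles using (Inverse)
open import Function.Properties.Inverse using (↔⇒↣)
open import Relation.Binary.Bundles using (Setoid; DecSetoid)
open import Relation.Binary.Definitions using (Decidable; DecidableEquality)
open import Relation.Nullary using (¬_; Dec; yes; no)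
open import Relation.Nullary.Decidable using (map′; via-injection)
open import Relation.Unary using (Pred)
open import Relation.Binary.PropositionalEquality using (_≡_; refl; sym; trans; cong; cong₂; subst; module ≡-Reasoning)

module LinearAlgebra (F : Field) where
  open Field F using (+-identityʳ; *-identityˡ; distribʳ; 0≢1)
    renaming (Carrier to A; _+ᶠ_ to _+_; 0ᶠ to 0#; 1ᶠ to 1#)
  open VecLemmas F using (⊕-zeros; zeros⊕zeros; 0⊙; ⊕-interchange)

  private
    infixl 6 _+ᵥ_
    infixr 7 _·_

    _+ᵥ_ : ∀ {k} → Vec A k → Vec A k → Vec A k
    _+ᵥ_ = _⊕_ F

    _·_ : ∀ {k} → A → Vec A k → Vec A k
    _·_ = _⊙_ F

    0ᵥ : ∀ {k} → Vec A k
    0ᵥ = zeros F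

  ⊕-identityʳ : ∀ {k} (v : Vec A k) → v +ᵥ 0ᵥ ≡ v
  ⊕-identityʳ = zipWith-identityʳ +-identityʳ

  ⊙-identityˡ : ∀ {k} (v : Vec A k) → 1# · v ≡ v
  ⊙-identityˡ v = trans (map-cong *-identityˡ v) (map-id v)

  ⊙-distribʳ : ∀ {k} a b (v : Vec A k) → (a + b) · v ≡ (a · v) +ᵥ (b · v)
  ⊙-distribʳ a b [] = refl
  ⊙-distribʳ a b (x ∷ v) = cong₂ _∷_ (distribʳ x a b) (⊙-distribʳ a b v)

  sumV-cong : ∀ {k j} {u v : Fin j → Vec A k} → (∀ i → u i ≡ v i) → sumV F u ≡ sumV F v
  sumV-cong {j = zero} u≗v = refl
  sumV-cong {j = suc j} u≗v = cong₂ _+ᵥ_ (u≗v zero) (sumV-cong (u≗v ∘ suc))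

  lincomb-congˡ : ∀ {k j} {c d : Fin j → A} (v : Fin j → Vec A k) →
    (∀ i → c i ≡ d i) → lincomb F c v ≡ lincomb F d v
  lincomb-congˡ v c≗d = sumV-cong (λ i → cong (_· v i) (c≗d i))

  lincomb-congʳ : ∀ {k j} (c : Fin j → A) {u v : Fin j → Vec A k} →
    (∀ i → u i ≡ v i) → lincomb F c u ≡ lincomb F c v
  lincomb-congʳ c u≗v = sumV-cong (λ i → cong (c i ·_) (u≗v i))

  lincomb-zeroˡ : ∀ {k j} (v : Fin j → Vec A k) → lincomb F (λ _ → 0#) v ≡ 0ᵥ
  lincomb-zeroˡ {j = zero} v = refl
  lincomb-zeroˡ {j = suc j} v =
    trans (cong₂ _+ᵥ_ (0⊙ (v zero)) (lincomb-zeroˡ (v ∘ suc))) zeros⊕zeros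

  lincomb-+ˡ : ∀ {k j} (c d : Fin j → A) (v : Fin j → Vec A k) →
    lincomb F (λ i → c i + d i) v ≡ lincomb F c v +ᵥ lincomb F d v
  lincomb-+ˡ {j = zero} c d v = sym zeros⊕zeros
  lincomb-+ˡ {j = suc j} c d v = trans
    (cong₂ _+ᵥ_ (⊙-distribʳ (c zero) (d zero) (v zero)) (lincomb-+ˡ (c ∘ suc) (d ∘ suc) (v ∘ suc)))
    (⊕-interchange _ _ _ _)

  single : ∀ {j} → Fin j → A → Fin j → A
  single zero    a zero    = a
  single zero    a (suc _) = 0#
  single (suc i) a zero    = 0#
  single (suc i) a (suc t) = single i a t

  single-same : ∀ {j} (i : Fin j) a → single i a i ≡ a
  single-same zero    a = refl
  single-same (suc i) a = single-same i a

  lincomb-single : ∀ {k j} (i : Fin j) a (v : Fin j → Vec A k) → lincomb F (single i a) v ≡ a · v i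
  lincomb-single zero a v =
    trans (cong (a · v zero +ᵥ_) (lincomb-zeroˡ (v ∘ suc))) (⊕-identityʳ _)
  lincomb-single (suc i) a v =
    trans (cong₂ _+ᵥ_ (0⊙ (v zero)) (lincomb-single i a (v ∘ suc))) (⊕-zeros _)

  linIndep⇒nonzero : ∀ {k j} {v : Fin j → Vec A k} → LinIndep F v → ∀ i → ¬ (v i ≡ 0ᵥ)
  linIndep⇒nonzero {v = v} indep i vᵢ≡0 =
    0≢1 (sym (trans (sym (single-same i 1#)) (indep (single i 1#) combination≡0 i)))
    where
    combination≡0 : lincomb F (single i 1#) v ≡ 0ᵥ
    combination≡0 = trans (lincomb-single i 1# v) (trans (⊙-identityˡ (v i)) vᵢ≡0)

  inSpan-zeros : ∀ {k j} (v : Fin j → Vec A k) → InSpan F v 0ᵥ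
  inSpan-zeros v = (λ _ → 0#) , lincomb-zeroˡ v

  inSpan-⊕ : ∀ {k j} {v : Fin j → Vec A k} {x y} → InSpan F v x → InSpan F v y → InSpan F v (x +ᵥ y)
  inSpan-⊕ {v = v} (c , refl) (d , refl) = (λ i → c i + d i) , lincomb-+ˡ c d v

  inSpan-multiple : ∀ {k j} (v : Fin j → Vec A k) a i → InSpan F v (a · v i)
  inSpan-multiple v a i = single i a , lincomb-single i a v

  restrict : ∀ {k N} → Subset N → (Fin N → Vec A k) → Fin N → Vec A k
  restrict T v c with c ∈? T
  ... | yes _ = v c
  ... | no  _ = 0ᵥ

  restrict-∈ : ∀ {k N} {T : Subset N} {v : Fin N → Vec A k} {c} → c ∈ T → restrict T v c ≡ v c
  restrict-∈ {T = T} {c = c} c∈T with c ∈? T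
  ... | yes _   = refl
  ... | no  c∉T = ⊥-elim (c∉T c∈T)

  restrict-∉ : ∀ {k N} {T : Subset N} {v : Fin N → Vec A k} {c} → c ∉ T → restrict T v c ≡ 0ᵥ
  restrict-∉ {T = T} {c = c} c∉T with c ∈? T
  ... | yes c∈T = ⊥-elim (c∉T c∈T)
  ... | no  _   = refl

  -- Linearly independent columns are nonzero, so a basis of all columns of u lies in T.
  isRankOf-restrict : ∀ {k N r} {T : Subset N} {u v : Fin N → Vec A k} →
    (∀ c → c ∈ T → u c ≡ v c) → (∀ c → c ∉ T → u c ≡ 0ᵥ) →
    IsRankOf F (λ _ → ⊤) u r → IsRankOf F (_∈ T) v r
  isRankOf-restrict {T = T} {u} {v} u≡v u≡0 (sel , _ , indep , spans) =
    sel , sel∈T , indep′ , spans′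
    where
    sel∈T : ∀ i → sel i ∈ T
    sel∈T i with sel i ∈? T
    ... | yes p = p
    ... | no  p = ⊥-elim (linIndep⇒nonzero indep i (u≡0 (sel i) p))

    u∘sel≗v∘sel : ∀ i → u (sel i) ≡ v (sel i)
    u∘sel≗v∘sel i = u≡v (sel i) (sel∈T i)

    indep′ : LinIndep F (v ∘ sel)
    indep′ c ≡0 = indep c (trans (lincomb-congʳ c u∘sel≗v∘sel) ≡0)

    spans′ : ∀ j → j ∈ T → InSpan F (v ∘ sel) (v j)
    spans′ j j∈T with spans j tt
    ... | c , ≡uⱼ = c , trans (lincomb-congʳ c (sym ∘ u∘sel≗v∘sel)) (trans ≡uⱼ (u≡v j j∈T))

+-group : Field → Group 0ℓ 0ℓ
+-group F = record { isGroup = Field.+-isGroup F }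

ι-0# : ∀ {K L m} (ext : Extension K L m) → ι ext (Field.0ᶠ K) ≡ Field.0ᶠ L
ι-0# {K} {L} ext = identityˡ-unique (ι ext 0#) (ι ext 0#)
  (trans (sym (ι-+ ext 0# 0#)) (cong (ι ext) (Field.+-identityˡ K 0#)))
  where
  open Field K using () renaming (0ᶠ to 0#)
  open GroupProperties (+-group L)

module _ {K L m} (ext : Extension K L m) where

  applyMatrix : ∀ {k n} → (Fin n → Vec (Field.Carrier L) k) → Vec (Field.Carrier K) n → Vec (Field.Carrier L) k
  applyMatrix G y = lincomb L (λ i → ι ext (lookup y i)) G

  applyMatrix-zeros : ∀ {k n} (G : Fin n → Vec (Field.Carrier L) k) → applyMatrix G (zeros K) ≡ zeros L
  applyMatrix-zeros G = trans
    (LinearAlgebra.lincomb-congˡ L G (λ i → trans (cong (ι ext) (lookup-replicate i _)) (ι-0# ext)))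
    (LinearAlgebra.lincomb-zeroˡ L G)

module _ (S : Setoid 0ℓ 0ℓ) where
  open Setoid S using (_≈_) renaming (sym to ≈-sym)
  open UniqueSetoid S using (Unique)

  unique-lookup-injective : ∀ {xs} → Unique xs →
    ∀ i j → List.lookup xs i ≈ List.lookup xs j → i ≡ j
  unique-lookup-injective (_ ∷ _)   zero    zero    _ = refl
  unique-lookup-injective (x≉ ∷ _)  zero    (suc j) e = ⊥-elim (All.lookup x≉ (∈-lookup j) e)
  unique-lookup-injective (x≉ ∷ _)  (suc i) zero    e = ⊥-elim (All.lookup x≉ (∈-lookup i) (≈-sym e))
  unique-lookup-injective (_ ∷ xs!) (suc i) (suc j) e = cong suc (unique-lookup-injective xs! i j e)

module Representatives (S : DecSetoid 0ℓ 0ℓ) (xs : List (DecSetoid.Carrier S))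
  (xs-enumerates : IsEnumeration (DecSetoid.setoid S) xs) where
  open DecSetoid S using (_≈_; _≟_; setoid; reflexive)
    renaming (Carrier to X; sym to ≈-sym; trans to ≈-trans)

  representatives : List X
  representatives = deduplicate _≟_ xs

  size : ℕ
  size = length representatives

  representative : Fin size → X
  representative = List.lookup representatives

  classOf : X → Fin size
  classOf x = index (deduplicate⁺ S xs-enumerates x)

  ≈-representative : ∀ x → x ≈ representative (classOf x)
  ≈-representative x = lookup-index (deduplicate⁺ S xs-enumerates x)

  representative-injective : ∀ i j → representative i ≈ representative j → i ≡ j
  representative-injective = unique-lookup-injective setoid (deduplicate-! S xs)

  classOf-cong : ∀ {x y} → x ≈ y → classOf x ≡ classOf y
  classOf-cong {x} {y} x≈y = representative-injective _ _
    (≈-trans (≈-sym (≈-representative x)) (≈-trans x≈y (≈-representative y)))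

  classOf-injective : ∀ {x y} → classOf x ≡ classOf y → x ≈ y
  classOf-injective {x} {y} e =
    ≈-trans (≈-representative x) (≈-trans (reflexive (cong representative e)) (≈-sym (≈-representative y)))

  classOf-representative : ∀ i → classOf (representative i) ≡ i
  classOf-representative i = representative-injective _ _ (≈-sym (≈-representative (representative i)))

module FiniteField {q : ℕ} (K : Field) (K↔Fin : FieldOfOrder q K) where
  open Field K using () renaming (Carrier to A)
  open Inverse K↔Fin using (to; from; strictlyInverseʳ)

  _≟_ : DecidableEquality A
  _≟_ = via-injection (↔⇒↣ K↔Fin) Fin._≟_

  any? : ∀ {p} {P : Pred A p} → (∀ x → Dec (P x)) → Dec (∃ P)
  any? {P = P} P? = map′
    (λ (i , p) → from i , p)
    (λ (x , p) → to x , subst P (sym (strictlyInverseʳ x)) p)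
    (Fin.any? (P? ∘ from))

  elements : List A
  elements = List.map from (allFin q)

  ∈-elements : ∀ x → x ∈ₗ elements
  ∈-elements x = subst (_∈ₗ elements) (strictlyInverseʳ x) (∈-map⁺ from (∈-allFin (to x)))

  vectors : ∀ n → List (Vec A n)
  vectors zero    = [] ∷ []
  vectors (suc n) = cartesianProductWith _∷_ elements (vectors n)

  ∈-vectors : ∀ {n} (v : Vec A n) → v ∈ₗ vectors n
  ∈-vectors []      = here refl
  ∈-vectors (x ∷ v) = ∈-cartesianProductWith⁺ _∷_ (∈-elements x) (∈-vectors v)

module Lines (K : Field) (n : ℕ) where
  open Field K using (*-assoc; *-comm; *-identityʳ; inverse)
    renaming (Carrier to A; _*ᶠ_ to _*_; 0ᶠ to 0#; 1ᶠ to 1#)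
  open VecLemmas K using (0⊙; ⊙-assoc)
  open LinearAlgebra K using (⊙-identityˡ)

  private
    _~_ : Line K n → Line K n → Set
    _~_ = SameLine K n

    _·_ : A → Vec A n → Vec A n
    _·_ = _⊙_ K

  sameLine-refl : ∀ {ℓ} → ℓ ~ ℓ
  sameLine-refl = (λ _ x∈ → x∈) , (λ _ x∈ → x∈)

  sameLine-sym : ∀ {ℓ ℓ′} → ℓ ~ ℓ′ → ℓ′ ~ ℓ
  sameLine-sym (⊆ , ⊇) = ⊇ , ⊆

  sameLine-trans : ∀ {ℓ ℓ′ ℓ″} → ℓ ~ ℓ′ → ℓ′ ~ ℓ″ → ℓ ~ ℓ″
  sameLine-trans (⊆₁ , ⊇₁) (⊆₂ , ⊇₂) = (λ x → ⊆₂ x ∘ ⊆₁ x) , (λ x → ⊇₁ x ∘ ⊇₂ x)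

  sameLine⇒multiple : ∀ {ℓ ℓ′} → ℓ ~ ℓ′ → Σ A λ c → c · proj₁ ℓ ≡ proj₁ ℓ′
  sameLine⇒multiple {ℓ′ = v′ , _} (_ , ⊇) = ⊇ v′ (1# , ⊙-identityˡ v′)

  multiple⇒sameLine : ∀ ℓ ℓ′ c → c · proj₁ ℓ ≡ proj₁ ℓ′ → ℓ ~ ℓ′
  multiple⇒sameLine (v , _) (_ , cv≢0) c refl = ⊆ , ⊇
    where
    c≢0 : ¬ (c ≡ 0#)
    c≢0 refl = cv≢0 (0⊙ v)

    c⁻¹ : A
    c⁻¹ = proj₁ (inverse c c≢0)

    cancel : ∀ d → (d * c⁻¹) * c ≡ d
    cancel d = begin
      (d * c⁻¹) * c ≡⟨ *-assoc d c⁻¹ c ⟩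
      d * (c⁻¹ * c) ≡⟨ cong (d *_) (*-comm c⁻¹ c) ⟩
      d * (c * c⁻¹) ≡⟨ cong (d *_) (proj₂ (inverse c c≢0)) ⟩
      d * 1#        ≡⟨ *-identityʳ d ⟩
      d             ∎
      where open ≡-Reasoning

    ⊆ : ∀ x → Σ A (λ d → d · v ≡ x) → Σ A (λ e → e · (c · v) ≡ x)
    ⊆ _ (d , refl) = d * c⁻¹ , trans (⊙-assoc (d * c⁻¹) c v) (cong (_· v) (cancel d))

    ⊇ : ∀ x → Σ A (λ e → e · (c · v) ≡ x) → Σ A (λ d → d · v ≡ x)
    ⊇ _ (e , refl) = e * c , sym (⊙-assoc e c v)

  module _ {q} (K↔Fin : FieldOfOrder q K) where
    open FiniteField K K↔Fin using (_≟_; any?; vectors; ∈-vectors)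

    sameLine? : Decidable _~_
    sameLine? ℓ ℓ′ = map′
      (λ (c , e) → multiple⇒sameLine ℓ ℓ′ c e)
      (sameLine⇒multiple {ℓ} {ℓ′})
      (any? (λ c → ≡-dec _≟_ (c · proj₁ ℓ) (proj₁ ℓ′)))

    lineDecSetoid : DecSetoid 0ℓ 0ℓ
    lineDecSetoid = record
      { Carrier = Line K n
      ; _≈_ = _~_
      ; isDecEquivalence = record
        { isEquivalence = record
          { refl  = λ {ℓ} → sameLine-refl {ℓ}
          ; sym   = λ {ℓ ℓ′} → sameLine-sym {ℓ} {ℓ′}
          ; trans = λ {ℓ ℓ′ ℓ″} → sameLine-trans {ℓ} {ℓ′} {ℓ″}
          }
        ; _≟_ = sameLine?
        }
      }

    linesThrough : List (Vec A n) → List (Line K n)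
    linesThrough []       = []
    linesThrough (v ∷ vs) with ≡-dec _≟_ v (zeros K)
    ... | yes _   = linesThrough vs
    ... | no  v≢0 = (v , v≢0) ∷ linesThrough vs

    ∈-linesThrough : ∀ ℓ {vs} → proj₁ ℓ ∈ₗ vs → Any (ℓ ~_) (linesThrough vs)
    ∈-linesThrough ℓ {v ∷ vs} v∈ with ≡-dec _≟_ v (zeros K)
    ∈-linesThrough ℓ (here refl) | yes v≡0 = ⊥-elim (proj₂ ℓ v≡0)
    ∈-linesThrough ℓ (there v∈) | yes _   = ∈-linesThrough ℓ v∈
    ∈-linesThrough ℓ (here refl) | no  _   = here (sameLine-refl {ℓ})
    ∈-linesThrough ℓ (there v∈) | no  _   = there (∈-linesThrough ℓ v∈)

    allLines : List (Line K n)
    allLines = linesThrough (vectors n)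

    allLines-enumerates : IsEnumeration (DecSetoid.setoid lineDecSetoid) allLines
    allLines-enumerates ℓ = ∈-linesThrough ℓ (∈-vectors (proj₁ ℓ))

module ProjectivizationRepresentation
  {q m n k : ℕ} {K L : Field} (K↔Fin : FieldOfOrder q K) (ext : Extension K L m)
  (M : QMatroid K n) (G : Fin n → Vec (Field.Carrier L) k) (φ : LinAut K n)
  (G-represents : ∀ U j (Y : Fin j → Vec (Field.Carrier K) n) →
    ColSpace K n Y (image K n φ U) → IsRankOf L (λ _ → ⊤) (GY ext G Y) (ρ M U)) where

  open Lines K n
  open Representatives (lineDecSetoid K↔Fin) (allLines K↔Fin) (allLines-enumerates K↔Fin)
  open LinearAlgebra K
    using (⊙-identityˡ; inSpan-zeros; inSpan-⊕; inSpan-multiple; restrict; restrict-∈; restrict-∉)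
  open VecLemmas K using (⊙-assoc)
  open Field K using () renaming (_*ᶠ_ to _*_; 1ᶠ to 1#)

  private
    infixr 7 _·_
    _·_ : Field.Carrier K → Vec (Field.Carrier K) n → Vec (Field.Carrier K) n
    _·_ = _⊙_ K

  spanningVector : Fin size → Vec (Field.Carrier K) n
  spanningVector i = fun φ (proj₁ (representative i))

  columns : Fin size → Vec (Field.Carrier L) k
  columns i = applyMatrix ext G (spanningVector i)

  representative-multiple : ∀ ℓ →
    Σ (Field.Carrier K) λ d → d · proj₁ (representative (classOf ℓ)) ≡ proj₁ ℓ
  representative-multiple ℓ = sameLine⇒multiple {representative (classOf ℓ)} {ℓ}
    (sameLine-sym {ℓ} {representative (classOf ℓ)} (≈-representative ℓ))

  linesIn : Subset size → Line K n → Set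
  linesIn T ℓ = classOf ℓ ∈ T

  module _ (T : Subset size) where
    private
      Y = restrict T spanningVector

    column∈image : ∀ i → mem (image K n φ (spanUnion K n (linesIn T))) (Y i)
    column∈image i with i ∈? T
    ... | yes i∈T = proj₁ (representative i) ,
      su-elem (representative i) _ (subst (_∈ T) (sym (classOf-representative i)) i∈T)
        (1# , ⊙-identityˡ _) ,
      refl
    ... | no _ = mem-zero (image K n φ (spanUnion K n (linesIn T)))

    image⊆span : ∀ {u} → InSpanUnion K n (linesIn T) u → InSpan K Y (fun φ u)
    image⊆span su-zero = subst (InSpan K Y) (sym (fun-zero K n φ)) (inSpan-zeros Y)
    image⊆span (su-add {x} {y} x∈ y∈) =
      subst (InSpan K Y) (sym (fun-add φ x y)) (inSpan-⊕ (image⊆span x∈) (image⊆span y∈))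
    image⊆span (su-elem ℓ _ ℓ∈T (c , refl)) with representative-multiple ℓ
    ... | d , dvᵢ≡v = subst (InSpan K Y) cdYᵢ≡φcv (inSpan-multiple Y (c * d) i)
      where
      i = classOf ℓ
      cdYᵢ≡φcv : (c * d) · Y i ≡ fun φ (c · proj₁ ℓ)
      cdYᵢ≡φcv = begin
        (c * d) · Y i                               ≡⟨ cong ((c * d) ·_) (restrict-∈ ℓ∈T) ⟩
        (c * d) · spanningVector i                  ≡⟨ sym (fun-scale φ (c * d) _) ⟩
        fun φ ((c * d) · proj₁ (representative i))  ≡⟨ cong (fun φ) (sym (⊙-assoc c d _)) ⟩
        fun φ (c · d · proj₁ (representative i))    ≡⟨ cong (λ v → fun φ (c · v)) dvᵢ≡v ⟩
        fun φ (c · proj₁ ℓ)                         ∎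
        where open ≡-Reasoning

    colSpace : ColSpace K n Y (image K n φ (spanUnion K n (linesIn T)))
    colSpace = column∈image , λ { _ (u , u∈ , refl) → image⊆span u∈ }

    columns-rank : IsRankOf L (_∈ T) columns (projRank K n M (linesIn T))
    columns-rank = LinearAlgebra.isRankOf-restrict L
      (λ c c∈T → cong (applyMatrix ext G) (restrict-∈ c∈T))
      (λ c c∉T → trans (cong (applyMatrix ext G) (restrict-∉ c∉T)) (applyMatrix-zeros ext G))
      (G-represents _ _ Y colSpace)

  projectivization-representable : MatRepresentable L (Line K n) (SameLine K n) (projRank K n M)
  projectivization-representable =
    k , size , columns , classOf ,
    (λ _ _ → classOf-cong) , (λ _ _ → classOf-injective) ,
    (λ i → representative i , classOf-representative i) ,
    columns-rank

corollary6p15 : (q m n : ℕ) (K L : Field) → FieldOfOrder q K →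
    (ext : Extension K L m) (M : QMatroid K n) →
    QRepresentable ext M →
    MatRepresentable L (Line K n) (SameLine K n) (projRank K n M)
corollary6p15 q m n K L K↔Fin ext M (k , G , φ , G-represents) =
  ProjectivizationRepresentation.projectivization-representable K↔Fin ext M G φ G-represents
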